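{- Let $w\in S_n$. Let $wk(w)$ be the number of $u\in S_n$ with $u\le w$ in the left weak Bruhat order, and $br(w)$ the number of $u\in S_n$ with $u\le w$ in the Bruhat order. Then $wk(w)=br(w)$ if and only if $w$ avoids the patterns $231$ and $312$.
   Context: Permutations are written in one-line notation $w=w_1\cdots w_n$, $w_i=w(i)$, with products as composition of functions. An inversion of $w$ is a pair $(i,j)$, $i<j$, $w_i>w_j$; $\mathrm{inv}(w)$ is the number of inversions. Bruhat order: $u\le v$ if there are transpositions $(i_1,j_1),\ldots,(i_k,j_k)$ with $v=u(i_1,j_1)\cdots(i_k,j_k)$ and $\mathrm{inv}(u(i_1,j_1)\cdots(i_r,j_r))=\mathrm{inv}(u)+r$ for $1\le r\le k$. Left weak Bruhat order: $u\le v$ if $v=s_{i_1}\cdots s_{i_k}u$ with $s_i=(i,i+1)$ adjacent transpositions and each successive left multiplication increasing $\mathrm{inv}$ by exactly one. $w$ avoids a pattern $\pi\in S_k$ if no subsequence $w_{i_1}\cdots w_{i_k}$ ($i_1<\cdots<i_k$) is order-isomorphic to $\pi$. -}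

module Defs where

open import Data.Nat using (ℕ; zero; suc; _+_)
open import Data.Fin using (Fin; zero; suc; toℕ; _<_; _<?_)
open import Data.Fin.Permutation.Components using (transpose)
open import Data.Vec using (Vec; lookup; tabulate; _∷_; [])
open import Data.Empty using (⊥)
open import Data.List using (List; allFin; map; length)
open import Data.Nat.ListAction using (sum)
open import Data.List.Membership.Propositional using (_∈_)
open import Data.List.Relation.Unary.Unique.Propositional using (Unique)
open import Data.Product using (Σ; _×_; _,_)
open import Data.Bool using (if_then_else_; _∧_)
open import Relation.Nullary using (does)
open import Relation.Binary.PropositionalEquality using (_≡_)
open import Function.Bundles using (_⇔_)

-- A word of length n over {0,…,n-1} in one-line notation: w = w(0) ⋯ w(n-1)
-- (0-indexed values and positions).
Word : ℕ → Set
Word n = Vec (Fin n) n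

IsPerm : ∀ {n} → Word n → Set
IsPerm {n} w = ∀ (i j : Fin n) → lookup w i ≡ lookup w j → i ≡ j

inv : ∀ {n} → Word n → ℕ
inv {n} w = sum (map (λ i → sum (map (λ j →
  if does (i <? j) ∧ does (lookup w j <? lookup w i) then 1 else 0)
  (allFin n))) (allFin n))

rmulT : ∀ {n} → Fin n → Fin n → Word n → Word n
rmulT i j u = tabulate (λ k → lookup u (transpose i j k))

lmulT : ∀ {n} → Fin n → Fin n → Word n → Word n
lmulT a b u = tabulate (λ k → transpose a b (lookup u k))

-- Bruhat order: v = u (i1,j1) ⋯ (ik,jk) with inv increasing by exactly one
-- at each step.
data BruhatLe {n : ℕ} : Word n → Word n → Set where
  bruhat-refl : ∀ {u} → BruhatLe u u
  bruhat-step : ∀ {u v} (i j : Fin n) →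
    inv (rmulT i j u) ≡ suc (inv u) → BruhatLe (rmulT i j u) v → BruhatLe u v

-- Left weak Bruhat order: v = s_{i1} ⋯ s_{ik} u, s_i = (i,i+1), each successive
-- left multiplication increasing inv by exactly one.
data WeakLe {n : ℕ} : Word n → Word n → Set where
  weak-refl : ∀ {u} → WeakLe u u
  weak-step : ∀ {u v} (a b : Fin n) → toℕ b ≡ suc (toℕ a) →
    inv (lmulT a b u) ≡ suc (inv u) → WeakLe (lmulT a b u) v → WeakLe u v

Contains : ∀ {n k} → Word n → Vec (Fin k) k → Set
Contains {n} {k} w π = Σ (Fin k → Fin n) λ f →
  (∀ a b → a < b → f a < f b) ×
  (∀ a b → (lookup π a < lookup π b) ⇔ (lookup w (f a) < lookup w (f b)))

Avoids : ∀ {n k} → Word n → Vec (Fin k) k → Set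
Avoids w π = Contains w π → ⊥

-- the patterns 231 and 312 (written 0-indexed: 120 and 201)
p231 : Vec (Fin 3) 3
p231 = suc zero ∷ suc (suc zero) ∷ zero ∷ []

p312 : Vec (Fin 3) 3
p312 = suc (suc zero) ∷ zero ∷ suc zero ∷ []

HasCard : ∀ {n} → (Word n → Set) → ℕ → Set
HasCard {n} P k = Σ (List (Word n)) λ xs →
  length xs ≡ k × Unique xs × (∀ x → P x ⇔ (x ∈ xs))

wk≡ : ∀ {n} → Word n → ℕ → Set
wk≡ w k = HasCard (λ u → IsPerm u × WeakLe u w) k

br≡ : ∀ {n} → Word n → ℕ → Set
br≡ w k = HasCard (λ u → IsPerm u × BruhatLe u w) k

module Submission where

-- Everything rests on an exchange lemma: for positions i < j with
-- v i < v j, swapping the two entries raises the inversion number, and by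
-- exactly one iff no entry between positions i and j has a value between
-- v i and v j.  Write u ⊑ w when every inversion of u is one of w.  Then:
--   * a Bruhat step is an ascent, and a left weak step s_a is the Bruhat
--     step at the positions of the values a, a + 1; so weak ⊆ Bruhat, and
--     weak steps only create inversions;
--   * u ⊑ w implies u ≤ w in left weak order (swap adjacent values upwards);
--   * if w avoids 231 and 312, ⊑ w is inherited down Bruhat steps, so every
--     u below w in Bruhat order is below it in weak order;
--   * an occurrence of 231 or 312, tightened to have no intermediate values,
--     gives a Bruhat cover of w with an inversion w lacks, hence not weakly
--     below w.

open import Defs
open import Data.Nat as ℕ using (ℕ; zero; suc; _+_; _∸_; z≤n; s≤s)
import Data.Nat.Properties as NP
open import Data.Fin as F using (Fin; zero; suc; toℕ; fromℕ<)
open import Data.Fin.Properties as FP using (_≟_; _<?_; toℕ-injective; <-cmp; <-trans; <-asym; <-irrefl; <⇒≢)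
open import Data.Fin.Permutation.Components using (transpose; transpose-inverse)
import Data.Fin.Permutation as Perm
open import Data.Vec using (Vec; lookup)
open import Data.Unit using (tt)
import Data.Vec.Properties as VP
open import Data.List as L using (List; []; _∷_; allFin; map; length)
open import Data.List.Relation.Unary.Any using (here; there)
import Data.List.Relation.Unary.All as All
open import Data.List.Relation.Unary.AllPairs using ([]; _∷_)
open import Data.List.Membership.Propositional using (_∈_)
open import Data.List.Relation.Unary.Unique.Propositional using (Unique)
import Data.List.Properties as LP
open import Data.Nat.ListAction using (sum)
open import Algebra.Properties.CommutativeMonoid.Sum NP.+-0-commutativeMonoid
  using (sum-cong-≗; sum-replicate-zero; ∑-distrib-+; sum-permute) renaming (sum to ∑)
open import Data.Bool using (if_then_else_; _∧_)
open import Data.Empty using (⊥; ⊥-elim)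
open import Data.Product using (Σ; _×_; _,_; proj₁; proj₂; ∃)
open import Data.Sum using (_⊎_; inj₁; inj₂)
open import Relation.Nullary using (does; Dec; yes; no; ¬_)
open import Relation.Nullary.Decidable using (_×-dec_; _→-dec_; False; toWitness; toWitnessFalse)
open import Relation.Binary using (tri<; tri≈; tri>)
open import Relation.Binary.PropositionalEquality
open import Function.Bundles using (_⇔_; mk⇔; Equivalence)
open import Function.Base using (_∘_; id; case_of_)

when : ∀ {P : Set} → Dec P → ℕ → ℕ
when d e = if does d then e else 0

𝟙 : ∀ {P : Set} → Dec P → ℕ
𝟙 d = when d 1

when-yes : ∀ {P : Set} (d : Dec P) e → P → when d e ≡ e
when-yes (yes _) e _ = refl
when-yes (no ¬p) e p = ⊥-elim (¬p p)

when-no : ∀ {P : Set} (d : Dec P) e → ¬ P → when d e ≡ 0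
when-no (yes p) e ¬p = ⊥-elim (¬p p)
when-no (no _) e _ = refl

when-⇔ : ∀ {P Q : Set} (d : Dec P) (d' : Dec Q) e → (P → Q) → (Q → P) → when d e ≡ when d' e
when-⇔ (yes p) (yes q) e f g = refl
when-⇔ (yes p) (no ¬q) e f g = ⊥-elim (¬q (f p))
when-⇔ (no ¬p) (yes q) e f g = ⊥-elim (¬p (g q))
when-⇔ (no ¬p) (no ¬q) e f g = refl

when-mono : ∀ {P : Set} (d : Dec P) {e e'} → e ℕ.≤ e' → when d e ℕ.≤ when d e'
when-mono (yes _) le = le
when-mono (no _) le = z≤n

when-≤ : ∀ {P : Set} (d : Dec P) e → when d e ℕ.≤ e
when-≤ (yes _) e = NP.≤-refl
when-≤ (no _) e = z≤n

𝟙-mono : ∀ {P Q : Set} (d : Dec P) (d' : Dec Q) → (P → Q) → 𝟙 d ℕ.≤ 𝟙 d'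
𝟙-mono (yes p) (yes q) f = NP.≤-refl
𝟙-mono (yes p) (no ¬q) f = ⊥-elim (¬q (f p))
𝟙-mono (no ¬p) d' f = z≤n

sumAllFin≡∑ : ∀ n (f : Fin n → ℕ) → sum (map f (allFin n)) ≡ ∑ f
sumAllFin≡∑ n f = trans (cong sum (LP.map-tabulate id f)) (sumTabulate n f)
  where
  sumTabulate : ∀ n (f : Fin n → ℕ) → sum (L.tabulate f) ≡ ∑ f
  sumTabulate zero f = refl
  sumTabulate (suc n) f = cong (f zero +_) (sumTabulate n (f ∘ suc))

∑-mono : ∀ {n} {f g : Fin n → ℕ} → (∀ x → f x ℕ.≤ g x) → ∑ f ℕ.≤ ∑ g
∑-mono {zero} le = z≤n
∑-mono {suc n} le = NP.+-mono-≤ (le zero) (∑-mono (le ∘ suc))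

∑-zero : ∀ n → ∑ {n} (λ _ → 0) ≡ 0
∑-zero = sum-replicate-zero

∑-point : ∀ {n} (p : Fin n) c → ∑ (λ y → when (y ≟ p) c) ≡ c
∑-point {suc n} zero c = trans (cong (c +_) (∑-zero n)) (NP.+-identityʳ c)
∑-point {suc n} (suc p) c = ∑-point p c

∑-transpose : ∀ {n} (i j : Fin n) (f : Fin n → ℕ) → ∑ (f ∘ transpose i j) ≡ ∑ f
∑-transpose i j f = sym (sum-permute f (Perm.transpose i j))

∑-balance : ∀ {n} {f g h k : Fin n → ℕ} → (∀ y → f y + h y ≡ g y + k y) →
            ∑ f + ∑ h ≡ ∑ g + ∑ k
∑-balance {f = f} {g} {h} {k} e =
  trans (sym (∑-distrib-+ f h)) (trans (sum-cong-≗ e) (∑-distrib-+ g k))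

inversion : ∀ {n} → Word n → Fin n → Fin n → ℕ
inversion w x y = when (x <? y) (𝟙 (lookup w y <? lookup w x))

inv≡∑ : ∀ {n} (w : Word n) → inv w ≡ ∑ λ x → ∑ (inversion w x)
inv≡∑ {n} w = trans (sumAllFin≡∑ n _)
  (sum-cong-≗ {n} λ x → trans (sumAllFin≡∑ n _) (sum-cong-≗ {n} λ y → conj (x <? y) (lookup w y <? lookup w x)))
  where
  conj : ∀ {P Q : Set} (d : Dec P) (d' : Dec Q) → (if does d ∧ does d' then 1 else 0) ≡ when d (𝟙 d')
  conj (yes _) d' = refl
  conj (no _) d' = refl

transpose-at-i : ∀ {n} (i j : Fin n) → transpose i j i ≡ j
transpose-at-i i j with i ≟ i
... | yes _ = refl
... | no i≢i = ⊥-elim (i≢i refl)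

transpose-at-j : ∀ {n} (i j : Fin n) → transpose i j j ≡ i
transpose-at-j i j with j ≟ i
... | yes j≡i = j≡i
... | no _ with j ≟ j
...   | yes _ = refl
...   | no j≢j = ⊥-elim (j≢j refl)

transpose-other : ∀ {n} (i j k : Fin n) → k ≢ i → k ≢ j → transpose i j k ≡ k
transpose-other i j k k≢i k≢j with k ≟ i
... | yes k≡i = ⊥-elim (k≢i k≡i)
... | no _ with k ≟ j
...   | yes k≡j = ⊥-elim (k≢j k≡j)
...   | no _ = refl

transpose-sym : ∀ {n} (i j k : Fin n) → transpose i j k ≡ transpose j i k
transpose-sym i j k = byCases (k ≟ i) (k ≟ j)
  where
  byCases : Dec (k ≡ i) → Dec (k ≡ j) → transpose i j k ≡ transpose j i k
  byCases (yes refl) (yes refl) = refl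
  byCases (yes refl) (no _) = trans (transpose-at-i i j) (sym (transpose-at-j j i))
  byCases (no _) (yes refl) = trans (transpose-at-j i j) (sym (transpose-at-i j i))
  byCases (no k≢i) (no k≢j) = trans (transpose-other i j k k≢i k≢j) (sym (transpose-other j i k k≢j k≢i))

transpose-involutive : ∀ {n} (i j k : Fin n) → transpose i j (transpose i j k) ≡ k
transpose-involutive i j k = trans (cong (transpose i j) (transpose-sym i j k)) (transpose-inverse i j)

transpose-self : ∀ {n} (i k : Fin n) → transpose i i k ≡ k
transpose-self i k = byCases (k ≟ i)
  where
  byCases : Dec (k ≡ i) → transpose i i k ≡ k
  byCases (yes refl) = transpose-at-i k k
  byCases (no k≢i) = transpose-other i i k k≢i k≢i

transpose-injective : ∀ {n} (i j : Fin n) {x y} → transpose i j x ≡ transpose i j y → x ≡ y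
transpose-injective i j {x} {y} e =
  trans (sym (transpose-involutive i j x)) (trans (cong (transpose i j) e) (transpose-involutive i j y))

lookup-rmulT : ∀ {n} (i j : Fin n) (u : Word n) k → lookup (rmulT i j u) k ≡ lookup u (transpose i j k)
lookup-rmulT i j u k = VP.lookup∘tabulate (λ k → lookup u (transpose i j k)) k

lookup-lmulT : ∀ {n} (a b : Fin n) (u : Word n) k → lookup (lmulT a b u) k ≡ transpose a b (lookup u k)
lookup-lmulT a b u k = VP.lookup∘tabulate (λ k → transpose a b (lookup u k)) k

rmulT-at-i : ∀ {n} (u : Word n) (i j : Fin n) → lookup (rmulT i j u) i ≡ lookup u j
rmulT-at-i u i j = trans (lookup-rmulT i j u i) (cong (lookup u) (transpose-at-i i j))

rmulT-at-j : ∀ {n} (u : Word n) (i j : Fin n) → lookup (rmulT i j u) j ≡ lookup u i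
rmulT-at-j u i j = trans (lookup-rmulT i j u j) (cong (lookup u) (transpose-at-j i j))

rmulT-other : ∀ {n} (u : Word n) (i j k : Fin n) → k ≢ i → k ≢ j → lookup (rmulT i j u) k ≡ lookup u k
rmulT-other u i j k k≢i k≢j = trans (lookup-rmulT i j u k) (cong (lookup u) (transpose-other i j k k≢i k≢j))

word-ext : ∀ {n} {u v : Word n} → (∀ k → lookup u k ≡ lookup v k) → u ≡ v
word-ext {u = u} {v} e =
  trans (sym (VP.tabulate∘lookup u)) (trans (VP.tabulate-cong e) (VP.tabulate∘lookup v))

rmulT-involutive : ∀ {n} (i j : Fin n) (u : Word n) → rmulT i j (rmulT i j u) ≡ u
rmulT-involutive i j u = word-ext λ k →
  trans (lookup-rmulT i j (rmulT i j u) k)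
    (trans (lookup-rmulT i j u (transpose i j k)) (cong (lookup u) (transpose-involutive i j k)))

rmulT-sym : ∀ {n} (i j : Fin n) (u : Word n) → rmulT i j u ≡ rmulT j i u
rmulT-sym i j u = word-ext λ k →
  trans (lookup-rmulT i j u k) (trans (cong (lookup u) (transpose-sym i j k)) (sym (lookup-rmulT j i u k)))

rmulT-self : ∀ {n} (i : Fin n) (u : Word n) → rmulT i i u ≡ u
rmulT-self i u = word-ext λ k → trans (lookup-rmulT i i u k) (cong (lookup u) (transpose-self i k))

rmulT-perm : ∀ {n} (i j : Fin n) (u : Word n) → IsPerm u → IsPerm (rmulT i j u)
rmulT-perm i j u pu x y e =
  transpose-injective i j (pu _ _ (trans (sym (lookup-rmulT i j u x)) (trans e (lookup-rmulT i j u y))))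

lmulT-perm : ∀ {n} (a b : Fin n) (u : Word n) → IsPerm u → IsPerm (lmulT a b u)
lmulT-perm a b u pu x y e =
  pu x y (transpose-injective a b (trans (sym (lookup-lmulT a b u x)) (trans e (lookup-lmulT a b u y))))

-- An injective word is surjective (pigeonhole), so every value has a position.
perm-surjective : ∀ {n} (u : Word n) → IsPerm u → ∀ a → ∃ λ p → lookup u p ≡ a
perm-surjective {n} u pu a with FP.any? (λ p → lookup u p ≟ a)
... | yes found = found
... | no missing = ⊥-elim (noMissingValue n refl a missing)
  where
  noMissingValue : ∀ m → m ≡ n → (a : Fin n) → ¬ (∃ λ p → lookup u p ≡ a) → ⊥
  noMissingValue zero refl () _
  noMissingValue (suc m) refl a missing
    with FP.pigeonhole (NP.n<1+n m) (λ p → F.punchOut {i = a} {j = lookup u p} (λ e → missing (p , sym e)))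
  ... | p , q , p<q , e = NP.<⇒≢ p<q (cong toℕ (pu p q
          (FP.punchOut-injective (λ e' → missing (p , sym e')) (λ e' → missing (q , sym e')) e)))

position : ∀ {n} (u : Word n) → IsPerm u → Fin n → Fin n
position u pu a = proj₁ (perm-surjective u pu a)

lookup-position : ∀ {n} (u : Word n) (pu : IsPerm u) a → lookup u (position u pu a) ≡ a
lookup-position u pu a = proj₂ (perm-surjective u pu a)

lmulT≡rmulT : ∀ {n} (u : Word n) (pu : IsPerm u) (a b : Fin n) →
              lmulT a b u ≡ rmulT (position u pu a) (position u pu b) u
lmulT≡rmulT {n} u pu a b = word-ext λ k →
  trans (lookup-lmulT a b u k) (trans (pointwise k (k ≟ p) (k ≟ q)) (sym (lookup-rmulT p q u k)))
  where
  p : Fin n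
  p = position u pu a
  q : Fin n
  q = position u pu b
  pointwise : ∀ k → Dec (k ≡ p) → Dec (k ≡ q) → transpose a b (lookup u k) ≡ lookup u (transpose p q k)
  pointwise k (yes refl) _ = begin
    transpose a b (lookup u p) ≡⟨ cong (transpose a b) (lookup-position u pu a) ⟩
    transpose a b a            ≡⟨ transpose-at-i a b ⟩
    b                          ≡⟨ sym (lookup-position u pu b) ⟩
    lookup u q                 ≡⟨ cong (lookup u) (sym (transpose-at-i p q)) ⟩
    lookup u (transpose p q p) ∎
    where open ≡-Reasoning
  pointwise k (no _) (yes refl) = begin
    transpose a b (lookup u q) ≡⟨ cong (transpose a b) (lookup-position u pu b) ⟩
    transpose a b b            ≡⟨ transpose-at-j a b ⟩
    a                          ≡⟨ sym (lookup-position u pu a) ⟩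
    lookup u p                 ≡⟨ cong (lookup u) (sym (transpose-at-j p q)) ⟩
    lookup u (transpose p q q) ∎
    where open ≡-Reasoning
  pointwise k (no k≢p) (no k≢q) =
    trans (transpose-other a b _ (λ e → k≢p (pu _ _ (trans e (sym (lookup-position u pu a)))))
                                 (λ e → k≢q (pu _ _ (trans e (sym (lookup-position u pu b))))))
          (cong (lookup u) (sym (transpose-other p q k k≢p k≢q)))

-- For positions i < j with v i < v j,
--   inv (v (i,j)) + (S₁ + A) = inv v + 1 + (S₂ + B),
-- where, counting over the positions k strictly between i and j,
--   S₁ = #{v k < v i},  A = #{v k > v j},  S₂ = #{v k < v j},  B = #{v k > v i}.
-- Since S₁ ≤ S₂ and A ≤ B, inv (v (i,j)) > inv v; and inv (v (i,j)) = inv v + 1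
-- when no entry between positions i and j has a value between v i and v j.
-- The identity is proved row by row on the inversion double sum, after
-- reindexing the sum for v (i,j) through the transposition σ = (i,j).

module Exchange {n} (v : Word n) (i j : Fin n) (i<j : i F.< j) (vi<vj : lookup v i F.< lookup v j) where

  σ : Fin n → Fin n
  σ = transpose i j

  vv : Fin n → Fin n
  vv = lookup v

  i≢j : i ≢ j
  i≢j = <⇒≢ i<j

  data Region (y : Fin n) : Set where
    at-i  : y ≡ i → Region y
    at-j  : y ≡ j → Region y
    below : y F.< i → Region y
    inner : i F.< y → y F.< j → Region y
    above : j F.< y → Region y

  region : ∀ y → Region y
  region y with <-cmp y i
  ... | tri< y<i _ _ = below y<i
  ... | tri≈ _ y≡i _ = at-i y≡i
  ... | tri> _ _ i<y with <-cmp y j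
  ...   | tri< y<j _ _ = inner i<y y<j
  ...   | tri≈ _ y≡j _ = at-j y≡j
  ...   | tri> _ _ j<y = above j<y

  σ-below : ∀ {y} → y F.< i → σ y ≡ y
  σ-below y<i = transpose-other i j _ (<⇒≢ y<i) (<⇒≢ (<-trans y<i i<j))

  σ-inner : ∀ {y} → i F.< y → y F.< j → σ y ≡ y
  σ-inner i<y y<j = transpose-other i j _ (≢-sym (<⇒≢ i<y)) (<⇒≢ y<j)

  σ-above : ∀ {y} → j F.< y → σ y ≡ y
  σ-above j<y = transpose-other i j _ (≢-sym (<⇒≢ (<-trans i<j j<y))) (≢-sym (<⇒≢ j<y))

  σ-outside : ∀ {y} → y F.< i ⊎ j F.< y → σ y ≡ y
  σ-outside (inj₁ y<i) = σ-below y<i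
  σ-outside (inj₂ j<y) = σ-above j<y

  σ-i : σ i ≡ j
  σ-i = transpose-at-i i j

  σ-j : σ j ≡ i
  σ-j = transpose-at-j i j

  inversionσ : Fin n → Fin n → ℕ
  inversionσ x y = when (σ x <? σ y) (𝟙 (vv y <? vv x))

  inv-rmulT : inv (rmulT i j v) ≡ ∑ λ x → ∑ (inversionσ x)
  inv-rmulT = begin
    inv (rmulT i j v)
      ≡⟨ inv≡∑ (rmulT i j v) ⟩
    ∑ (λ x → ∑ λ y → when (x <? y) (𝟙 (lookup (rmulT i j v) y <? lookup (rmulT i j v) x)))
      ≡⟨ sum-cong-≗ {n} (λ x → sum-cong-≗ {n} λ y → cong₂ (λ a b → when (x <? y) (𝟙 (a <? b)))
                                               (lookup-rmulT i j v y) (lookup-rmulT i j v x)) ⟩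
    ∑ (λ x → ∑ λ y → when (x <? y) (𝟙 (vv (σ y) <? vv (σ x))))
      ≡⟨ sym (∑-transpose i j _) ⟩
    ∑ (λ x → ∑ λ y → when (σ x <? y) (𝟙 (vv (σ y) <? vv (σ (σ x)))))
      ≡⟨ sum-cong-≗ {n} (λ x → sym (∑-transpose i j _)) ⟩
    ∑ (λ x → ∑ λ y → when (σ x <? σ y) (𝟙 (vv (σ (σ y)) <? vv (σ (σ x)))))
      ≡⟨ sum-cong-≗ {n} (λ x → sum-cong-≗ {n} λ y → cong₂ (λ a b → when (σ x <? σ y) (𝟙 (vv a <? vv b)))
                                               (transpose-involutive i j y) (transpose-involutive i j x)) ⟩
    ∑ (λ x → ∑ (inversionσ x)) ∎
    where open ≡-Reasoning

  σ-guard-yes : ∀ x y {a b} → σ x ≡ a → σ y ≡ b → a F.< b → inversionσ x y ≡ 𝟙 (vv y <? vv x)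
  σ-guard-yes x y refl refl a<b = when-yes (σ x <? σ y) _ a<b

  σ-guard-no : ∀ x y {a b} → σ x ≡ a → σ y ≡ b → ¬ (a F.< b) → inversionσ x y ≡ 0
  σ-guard-no x y refl refl a≮b = when-no (σ x <? σ y) _ a≮b

  guard-yes : ∀ x y → x F.< y → inversion v x y ≡ 𝟙 (vv y <? vv x)
  guard-yes x y x<y = when-yes (x <? y) _ x<y

  guard-no : ∀ x y → ¬ (x F.< y) → inversion v x y ≡ 0
  guard-no x y x≮y = when-no (x <? y) _ x≮y

  σ-fixed : ∀ x y → σ x ≡ x → σ y ≡ y → inversionσ x y ≡ inversion v x y
  σ-fixed x y σx σy = when-⇔ (σ x <? σ y) (x <? y) _
    (subst₂ F._<_ σx σy) (subst₂ F._<_ (sym σx) (sym σy))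

  inside? : ∀ (y : Fin n) → Dec (i F.< y × y F.< j)
  inside? y = (i <? y) ×-dec (y <? j)

  inside : (Fin n → ℕ) → Fin n → ℕ
  inside c y = when (inside? y) (c y)

  inside-yes : ∀ c (y : Fin n) → i F.< y → y F.< j → inside c y ≡ c y
  inside-yes c y i<y y<j = when-yes (inside? y) _ (i<y , y<j)

  inside-no : ∀ c (y : Fin n) → ¬ (i F.< y × y F.< j) → inside c y ≡ 0
  inside-no c y out = when-no (inside? y) _ out

  balance : ∀ {g p f q a b a' b' : ℕ} → g ≡ a → p ≡ b → f ≡ a' → q ≡ b' →
            a + b ≡ a' + b' → g + p ≡ f + q
  balance refl refl refl refl e = e

  -- Rows x outside [i, j] are unchanged: σ preserves the order of x and any y.
  row-outside : ∀ {x} → x F.< i ⊎ j F.< x → ∀ y → inversionσ x y ≡ inversion v x y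
  row-outside {x} out y = when-⇔ (σ x <? σ y) (x <? y) _ (backward out (region y)) (forward out (region y))
    where
    σx : σ x ≡ x
    σx = σ-outside out
    forward : x F.< i ⊎ j F.< x → Region y → x F.< y → σ x F.< σ y
    forward _ (at-i refl) x<i = subst₂ F._<_ (sym σx) (sym σ-i) (<-trans x<i i<j)
    forward (inj₁ x<i) (at-j refl) _ = subst₂ F._<_ (sym σx) (sym σ-j) x<i
    forward (inj₂ j<x) (at-j refl) x<j = ⊥-elim (<-asym x<j j<x)
    forward _ (below y<i) x<y = subst₂ F._<_ (sym σx) (sym (σ-below y<i)) x<y
    forward _ (inner i<y y<j) x<y = subst₂ F._<_ (sym σx) (sym (σ-inner i<y y<j)) x<y
    forward _ (above j<y) x<y = subst₂ F._<_ (sym σx) (sym (σ-above j<y)) x<y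
    backward : x F.< i ⊎ j F.< x → Region y → σ x F.< σ y → x F.< y
    backward (inj₁ x<i) (at-i refl) _ = x<i
    backward (inj₂ j<x) (at-i refl) x<j = ⊥-elim (<-asym (subst₂ F._<_ σx σ-i x<j) j<x)
    backward _ (at-j refl) x<i = <-trans (subst₂ F._<_ σx σ-j x<i) i<j
    backward _ (below y<i) x<y = subst₂ F._<_ σx (σ-below y<i) x<y
    backward _ (inner i<y y<j) x<y = subst₂ F._<_ σx (σ-inner i<y y<j) x<y
    backward _ (above j<y) x<y = subst₂ F._<_ σx (σ-above j<y) x<y

  -- Rows x strictly between i and j: only the columns i and j change.
  row-inner : ∀ {x} → i F.< x → x F.< j → ∀ y →
    inversionσ x y + when (y ≟ j) (𝟙 (vv j <? vv x)) ≡ inversion v x y + when (y ≟ i) (𝟙 (vv i <? vv x))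
  row-inner {x} i<x x<j y with region y
  ... | at-i refl = balance (σ-guard-yes x i (σ-inner i<x x<j) σ-i x<j) (when-no (i ≟ j) _ i≢j)
                            (guard-no x i (<-asym i<x)) (when-yes (i ≟ i) _ refl) (NP.+-identityʳ _)
  ... | at-j refl = balance (σ-guard-no x j (σ-inner i<x x<j) σ-j (<-asym i<x)) (when-yes (j ≟ j) _ refl)
                            (guard-yes x j x<j) (when-no (j ≟ i) _ (≢-sym i≢j)) (sym (NP.+-identityʳ _))
  ... | below y<i = balance (σ-fixed x y (σ-inner i<x x<j) (σ-below y<i)) (when-no (y ≟ j) _ (<⇒≢ (<-trans y<i i<j)))
                            refl (when-no (y ≟ i) _ (<⇒≢ y<i)) refl
  ... | inner i<y y<j = balance (σ-fixed x y (σ-inner i<x x<j) (σ-inner i<y y<j)) (when-no (y ≟ j) _ (<⇒≢ y<j))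
                            refl (when-no (y ≟ i) _ (≢-sym (<⇒≢ i<y))) refl
  ... | above j<y = balance (σ-fixed x y (σ-inner i<x x<j) (σ-above j<y)) (when-no (y ≟ j) _ (≢-sym (<⇒≢ j<y)))
                            refl (when-no (y ≟ i) _ (≢-sym (<⇒≢ (<-trans i<j j<y)))) refl

  belowVi belowVj aboveVi aboveVj : Fin n → ℕ
  belowVi y = 𝟙 (vv y <? vv i)
  belowVj y = 𝟙 (vv y <? vv j)
  aboveVi y = 𝟙 (vv i <? vv y)
  aboveVj y = 𝟙 (vv j <? vv y)

  -- Row i loses the inversions (i, y) with i < y < j and v y < v i.
  row-i : ∀ y → inversionσ i y + inside belowVi y ≡ inversion v i y + 0
  row-i y with region y
  ... | at-i refl = balance (σ-guard-no i i σ-i σ-i (<-irrefl refl)) (inside-no belowVi i (λ (i<i , _) → <-irrefl refl i<i))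
                            (guard-no i i (<-irrefl refl)) refl refl
  ... | at-j refl = balance (σ-guard-no i j σ-i σ-j (<-asym i<j)) (inside-no belowVi j (λ (_ , j<j) → <-irrefl refl j<j))
                            (trans (guard-yes i j i<j) (when-no (vv j <? vv i) 1 (<-asym vi<vj))) refl refl
  ... | below y<i = balance (σ-guard-no i y σ-i (σ-below y<i) (<-asym (<-trans y<i i<j)))
                            (inside-no belowVi y (λ (i<y , _) → <-asym y<i i<y)) (guard-no i y (<-asym y<i)) refl refl
  ... | inner i<y y<j = balance (σ-guard-no i y σ-i (σ-inner i<y y<j) (<-asym y<j)) (inside-yes belowVi y i<y y<j)
                            (guard-yes i y i<y) refl (sym (NP.+-identityʳ _))
  ... | above j<y = balance (σ-guard-yes i y σ-i (σ-above j<y) j<y) (inside-no belowVi y (λ (_ , y<j) → <-asym y<j j<y))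
                            (guard-yes i y (<-trans i<j j<y)) refl refl

  -- Row j gains the inversion (j, i) and those (j, y) with i < y < j and v y < v j.
  row-j : ∀ y → inversionσ j y + 0 ≡ inversion v j y + (when (y ≟ i) 1 + inside belowVj y)
  row-j y with region y
  ... | at-i refl = balance (trans (σ-guard-yes j i σ-j σ-i i<j) (when-yes (vv i <? vv j) 1 vi<vj)) refl
                            (guard-no j i (<-asym i<j))
                            (cong₂ _+_ (when-yes (i ≟ i) 1 refl) (inside-no belowVj i (λ (i<i , _) → <-irrefl refl i<i))) refl
  ... | at-j refl = balance (σ-guard-no j j σ-j σ-j (<-irrefl refl)) refl (guard-no j j (<-irrefl refl))
                            (cong₂ _+_ (when-no (j ≟ i) 1 (≢-sym i≢j)) (inside-no belowVj j (λ (_ , j<j) → <-irrefl refl j<j))) refl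
  ... | below y<i = balance (σ-guard-no j y σ-j (σ-below y<i) (<-asym y<i)) refl (guard-no j y (<-asym (<-trans y<i i<j)))
                            (cong₂ _+_ (when-no (y ≟ i) 1 (<⇒≢ y<i)) (inside-no belowVj y (λ (i<y , _) → <-asym y<i i<y))) refl
  ... | inner i<y y<j = balance (σ-guard-yes j y σ-j (σ-inner i<y y<j) i<y) refl (guard-no j y (<-asym y<j))
                            (cong₂ _+_ (when-no (y ≟ i) 1 (≢-sym (<⇒≢ i<y))) (inside-yes belowVj y i<y y<j)) (NP.+-identityʳ _)
  ... | above j<y = balance (σ-guard-yes j y σ-j (σ-above j<y) (<-trans i<j j<y)) refl (guard-yes j y j<y)
                            (cong₂ _+_ (when-no (y ≟ i) 1 (≢-sym (<⇒≢ (<-trans i<j j<y))))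
                                       (inside-no belowVj y (λ (_ , y<j) → <-asym y<j j<y))) refl

  rowσ row : Fin n → ℕ
  rowσ x = ∑ (inversionσ x)
  row x = ∑ (inversion v x)

  S₁ S₂ A B : ℕ
  S₁ = ∑ (inside belowVi)
  S₂ = ∑ (inside belowVj)
  A = ∑ (inside aboveVj)
  B = ∑ (inside aboveVi)

  correct : ∀ x {p q b b'} → p ≡ b → q ≡ b' → rowσ x + b ≡ row x + b' → rowσ x + p ≡ row x + q
  correct x refl refl e = e

  rowSum : ∀ x → rowσ x + (when (x ≟ i) S₁ + inside aboveVj x) ≡ row x + (when (x ≟ j) (suc S₂) + inside aboveVi x)
  rowSum x with region x
  ... | at-i refl = correct x (cong₂ _+_ (when-yes (i ≟ i) S₁ refl) (inside-no aboveVj i (λ (i<i , _) → <-irrefl refl i<i)))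
                            (cong₂ _+_ (when-no (i ≟ j) _ i≢j) (inside-no aboveVi i (λ (i<i , _) → <-irrefl refl i<i)))
                            (trans (cong (rowσ i +_) (NP.+-identityʳ S₁))
                              (trans (∑-balance row-i) (cong (row i +_) (∑-zero n))))
  ... | at-j refl = correct x (cong₂ _+_ (when-no (j ≟ i) S₁ (≢-sym i≢j)) (inside-no aboveVj j (λ (_ , j<j) → <-irrefl refl j<j)))
                            (cong₂ _+_ (when-yes (j ≟ j) _ refl) (inside-no aboveVi j (λ (_ , j<j) → <-irrefl refl j<j)))
                            (trans (cong (rowσ j +_) (sym (∑-zero n)))
                              (trans (∑-balance row-j)
                                (cong (row j +_) (trans (∑-distrib-+ {n} _ _)
                                  (trans (cong (_+ S₂) (∑-point i 1)) (sym (NP.+-identityʳ _)))))))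
  ... | below x<i = correct x (cong₂ _+_ (when-no (x ≟ i) S₁ (<⇒≢ x<i)) (inside-no aboveVj x (λ (i<x , _) → <-asym x<i i<x)))
                            (cong₂ _+_ (when-no (x ≟ j) _ (<⇒≢ (<-trans x<i i<j))) (inside-no aboveVi x (λ (i<x , _) → <-asym x<i i<x)))
                            (cong (_+ 0) (sum-cong-≗ {n} (row-outside (inj₁ x<i))))
  ... | above j<x = correct x (cong₂ _+_ (when-no (x ≟ i) S₁ (≢-sym (<⇒≢ (<-trans i<j j<x)))) (inside-no aboveVj x (λ (_ , x<j) → <-asym x<j j<x)))
                            (cong₂ _+_ (when-no (x ≟ j) _ (≢-sym (<⇒≢ j<x))) (inside-no aboveVi x (λ (_ , x<j) → <-asym x<j j<x)))
                            (cong (_+ 0) (sum-cong-≗ {n} (row-outside (inj₂ j<x))))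
  ... | inner i<x x<j = correct x (cong₂ _+_ (when-no (x ≟ i) S₁ (≢-sym (<⇒≢ i<x))) (inside-yes aboveVj x i<x x<j))
                            (cong₂ _+_ (when-no (x ≟ j) _ (<⇒≢ x<j)) (inside-yes aboveVi x i<x x<j))
                            (trans (cong (rowσ x +_) (sym (∑-point j _)))
                              (trans (∑-balance (row-inner i<x x<j)) (cong (row x +_) (∑-point i _))))

  exchange-identity : inv (rmulT i j v) + (S₁ + A) ≡ inv v + suc (S₂ + B)
  exchange-identity = begin
    inv (rmulT i j v) + (S₁ + A)
      ≡⟨ cong₂ _+_ inv-rmulT (sym (trans (∑-distrib-+ {n} _ _) (cong (_+ A) (∑-point i S₁)))) ⟩
    ∑ rowσ + ∑ (λ x → when (x ≟ i) S₁ + inside aboveVj x)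
      ≡⟨ ∑-balance rowSum ⟩
    ∑ row + ∑ (λ x → when (x ≟ j) (suc S₂) + inside aboveVi x)
      ≡⟨ cong₂ _+_ (sym (inv≡∑ v)) (trans (∑-distrib-+ {n} _ _) (cong (_+ B) (∑-point j (suc S₂)))) ⟩
    inv v + suc (S₂ + B) ∎
    where open ≡-Reasoning

  S₁≤S₂ : S₁ ℕ.≤ S₂
  S₁≤S₂ = ∑-mono λ y → when-mono (inside? y) (𝟙-mono (vv y <? vv i) (vv y <? vv j) (λ vy<vi → <-trans vy<vi vi<vj))

  A≤B : A ℕ.≤ B
  A≤B = ∑-mono λ y → when-mono (inside? y) (𝟙-mono (vv j <? vv y) (vv i <? vv y) (<-trans vi<vj))

  exchange-increases : suc (inv v) ℕ.≤ inv (rmulT i j v)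
  exchange-increases = NP.+-cancelʳ-≤ (S₁ + A) (suc (inv v)) (inv (rmulT i j v)) (begin
    suc (inv v) + (S₁ + A)       ≤⟨ NP.+-monoʳ-≤ (suc (inv v)) (NP.+-mono-≤ S₁≤S₂ A≤B) ⟩
    suc (inv v) + (S₂ + B)       ≡⟨ NP.+-suc (inv v) (S₂ + B) ⟨
    inv v + suc (S₂ + B)         ≡⟨ exchange-identity ⟨
    inv (rmulT i j v) + (S₁ + A) ∎)
    where open NP.≤-Reasoning

  NoValueBetween : Set
  NoValueBetween = ∀ k → i F.< k → k F.< j → vv k F.< vv i ⊎ vv j F.< vv k

  exchange-covers : NoValueBetween → inv (rmulT i j v) ≡ suc (inv v)
  exchange-covers gap = NP.+-cancelʳ-≡ (S₁ + A) _ _ (begin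
    inv (rmulT i j v) + (S₁ + A) ≡⟨ exchange-identity ⟩
    inv v + suc (S₂ + B)         ≡⟨ NP.+-suc (inv v) (S₂ + B) ⟩
    suc (inv v) + (S₂ + B)       ≡⟨ cong (suc (inv v) +_) (cong₂ _+_ S₁≡S₂ A≡B) ⟨
    suc (inv v) + (S₁ + A)       ∎)
    where
    open ≡-Reasoning
    inside-cong : ∀ (c c' : Fin n → ℕ) → (∀ k → i F.< k → k F.< j → c k ≡ c' k) → ∑ (inside c) ≡ ∑ (inside c')
    inside-cong c c' same = sum-cong-≗ {n} λ k → byCases k (inside? k)
      where
      byCases : ∀ k (d : Dec (i F.< k × k F.< j)) → when d (c k) ≡ when d (c' k)
      byCases k (yes (i<k , k<j)) = same k i<k k<j
      byCases k (no _) = refl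
    S₁≡S₂ : S₁ ≡ S₂
    S₁≡S₂ = inside-cong belowVi belowVj λ k i<k k<j →
      when-⇔ (vv k <? vv i) (vv k <? vv j) 1 (λ vk<vi → <-trans vk<vi vi<vj) λ vk<vj → case gap k i<k k<j of λ where
        (inj₁ vk<vi) → vk<vi
        (inj₂ vj<vk) → ⊥-elim (<-asym vk<vj vj<vk)
    A≡B : A ≡ B
    A≡B = inside-cong aboveVj aboveVi λ k i<k k<j →
      when-⇔ (vv j <? vv k) (vv i <? vv k) 1 (<-trans vi<vj) λ vi<vk → case gap k i<k k<j of λ where
        (inj₁ vk<vi) → ⊥-elim (<-asym vk<vi vi<vk)
        (inj₂ vj<vk) → vj<vk

ascent-of-step : ∀ {n} (u : Word n) → IsPerm u → (i j : Fin n) → i F.< j →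
                 inv (rmulT i j u) ≡ suc (inv u) → lookup u i F.< lookup u j
ascent-of-step u pu i j i<j step with <-cmp (lookup u i) (lookup u j)
... | tri< ui<uj _ _ = ui<uj
... | tri≈ _ ui≡uj _ = ⊥-elim (<⇒≢ i<j (pu i j ui≡uj))
... | tri> _ _ uj<ui = ⊥-elim (NP.<-irrefl refl (begin-strict
    inv u                        <⟨ NP.n<1+n (inv u) ⟩
    suc (inv u)                  ≡⟨ step ⟨
    inv (rmulT i j u)            <⟨ Exchange.exchange-increases (rmulT i j u) i j i<j swapped-ascent ⟩
    inv (rmulT i j (rmulT i j u)) ≡⟨ cong inv (rmulT-involutive i j u) ⟩
    inv u                        ∎))
  where
  open NP.≤-Reasoning
  swapped-ascent : lookup (rmulT i j u) i F.< lookup (rmulT i j u) j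
  swapped-ascent = subst₂ F._<_ (sym (rmulT-at-i u i j)) (sym (rmulT-at-j u i j)) uj<ui

bruhat-step-ascent : ∀ {n} (u : Word n) → IsPerm u → (i j : Fin n) →
  inv (rmulT i j u) ≡ suc (inv u) →
  (i F.< j × lookup u i F.< lookup u j) ⊎ (j F.< i × lookup u j F.< lookup u i)
bruhat-step-ascent u pu i j step with <-cmp i j
... | tri< i<j _ _ = inj₁ (i<j , ascent-of-step u pu i j i<j step)
... | tri≈ _ refl _ = ⊥-elim (NP.1+n≢n (trans (sym step) (cong inv (rmulT-self i u))))
... | tri> _ _ j<i = inj₂ (j<i , ascent-of-step u pu j i j<i (trans (cong inv (rmulT-sym j i u)) step))

-- Every left weak step is a Bruhat step, so u ≤ w weakly implies u ≤ w in Bruhat order.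
weak⇒bruhat : ∀ {n} {w : Word n} (u : Word n) → IsPerm u → WeakLe u w → BruhatLe u w
weak⇒bruhat u pu weak-refl = bruhat-refl
weak⇒bruhat {n} {w} u pu (weak-step a b _ step rest) =
  bruhat-step p q (subst (λ t → inv t ≡ suc (inv u)) as-rmulT step)
    (subst (λ t → BruhatLe t w) as-rmulT (weak⇒bruhat (lmulT a b u) (lmulT-perm a b u pu) rest))
  where
  p : Fin n
  p = position u pu a
  q : Fin n
  q = position u pu b
  as-rmulT : lmulT a b u ≡ rmulT p q u
  as-rmulT = lmulT≡rmulT u pu a b

Adjacent : ∀ {n} → Fin n → Fin n → Set
Adjacent a b = toℕ b ≡ suc (toℕ a)

adjacent⇒< : ∀ {n} {a b : Fin n} → Adjacent a b → a F.< b
adjacent⇒< e = NP.≤-reflexive (sym e)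

adjacent-gap : ∀ {n} {a b t : Fin n} → Adjacent a b → t ≢ a → t ≢ b → t F.< a ⊎ b F.< t
adjacent-gap {a = a} {b} {t} adj t≢a t≢b with <-cmp t a
... | tri< t<a _ _ = inj₁ t<a
... | tri≈ _ t≡a _ = ⊥-elim (t≢a t≡a)
... | tri> _ _ a<t with <-cmp t b
...   | tri< t<b _ _ = ⊥-elim (NP.<-irrefl refl (NP.<-≤-trans t<b (subst (ℕ._≤ toℕ t) (sym adj) a<t)))
...   | tri≈ _ t≡b _ = ⊥-elim (t≢b t≡b)
...   | tri> _ _ b<t = inj₂ b<t

adjacent-transpose-monotone : ∀ {n} (a b : Fin n) → Adjacent a b → ∀ c d → c F.< d →
                              ¬ (c ≡ a × d ≡ b) → transpose a b c F.< transpose a b d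
adjacent-transpose-monotone {n} a b adj c d c<d not-ab = byCases (c ≟ a) (c ≟ b) (d ≟ a) (d ≟ b)
  where
  a<b : a F.< b
  a<b = adjacent⇒< {a = a} {b} adj
  τ : Fin n → Fin n
  τ = transpose a b
  byCases : Dec (c ≡ a) → Dec (c ≡ b) → Dec (d ≡ a) → Dec (d ≡ b) → τ c F.< τ d
  byCases (yes refl) _ _ (yes refl) = ⊥-elim (not-ab (refl , refl))
  byCases (yes refl) _ (yes refl) (no _) = ⊥-elim (<-irrefl refl c<d)
  byCases (yes refl) _ (no d≢a) (no d≢b) with adjacent-gap adj d≢a d≢b
  ... | inj₁ d<a = ⊥-elim (<-asym c<d d<a)
  ... | inj₂ b<d = subst₂ F._<_ (sym (transpose-at-i a b)) (sym (transpose-other a b d d≢a d≢b)) b<d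
  byCases (no _) (yes refl) (yes refl) _ = ⊥-elim (<-asym c<d a<b)
  byCases (no _) (yes refl) (no _) (yes refl) = ⊥-elim (<-irrefl refl c<d)
  byCases (no _) (yes refl) (no d≢a) (no d≢b) =
    subst₂ F._<_ (sym (transpose-at-j a b)) (sym (transpose-other a b d d≢a d≢b)) (<-trans a<b c<d)
  byCases (no c≢a) (no c≢b) (yes refl) _ =
    subst₂ F._<_ (sym (transpose-other a b c c≢a c≢b)) (sym (transpose-at-i a b)) (<-trans c<d a<b)
  byCases (no c≢a) (no c≢b) (no _) (yes refl) with adjacent-gap adj c≢a c≢b
  ... | inj₁ c<a = subst₂ F._<_ (sym (transpose-other a b c c≢a c≢b)) (sym (transpose-at-j a b)) c<a
  ... | inj₂ b<c = ⊥-elim (<-asym c<d b<c)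
  byCases (no c≢a) (no c≢b) (no d≢a) (no d≢b) =
    subst₂ F._<_ (sym (transpose-other a b c c≢a c≢b)) (sym (transpose-other a b d d≢a d≢b)) c<d

weak-keeps-inversions : ∀ {n} {v : Word n} (u : Word n) → IsPerm u → WeakLe u v →
                        ∀ x y → x F.< y → lookup u y F.< lookup u x → lookup v y F.< lookup v x
weak-keeps-inversions u pu weak-refl x y x<y uy<ux = uy<ux
weak-keeps-inversions {n} u pu (weak-step a b adj step rest) x y x<y uy<ux =
  weak-keeps-inversions (lmulT a b u) (lmulT-perm a b u pu) rest x y x<y still-inverted
  where
  p q : Fin n
  p = position u pu a
  q = position u pu b
  -- the step swaps the values a < b, which occur in this order in u
  p<q : p F.< q
  p<q with bruhat-step-ascent u pu p q (subst (λ t → inv t ≡ suc (inv u)) (lmulT≡rmulT u pu a b) step)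
  ... | inj₁ (p<q , _) = p<q
  ... | inj₂ (_ , ub<ua) = ⊥-elim (<-asym (adjacent⇒< {a = a} {b} adj)
                             (subst₂ F._<_ (lookup-position u pu b) (lookup-position u pu a) ub<ua))
  not-ab : ¬ (lookup u y ≡ a × lookup u x ≡ b)
  not-ab (uy≡a , ux≡b) with pu y p (trans uy≡a (sym (lookup-position u pu a)))
                          | pu x q (trans ux≡b (sym (lookup-position u pu b)))
  ... | refl | refl = <-asym x<y p<q
  still-inverted : lookup (lmulT a b u) y F.< lookup (lmulT a b u) x
  still-inverted = subst₂ F._<_ (sym (lookup-lmulT a b u y)) (sym (lookup-lmulT a b u x))
    (adjacent-transpose-monotone a b adj (lookup u y) (lookup u x) uy<ux not-ab)

-- A self-map of Fin n that increases along every adjacent pair a, a + 1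
-- is the identity: it cannot fall below a (induction from 0) nor exceed a
-- (induction from the top).
module AdjacentIncreasing {n} (g : Fin n → Fin n) (increasing : ∀ a b → Adjacent a b → g a F.< g b) where

  at-least : ∀ m (a : Fin n) → toℕ a ≡ m → m ℕ.≤ toℕ (g a)
  at-least zero a _ = z≤n
  at-least (suc m) a a≡1+m = NP.<-≤-trans (s≤s (at-least m a' (FP.toℕ-fromℕ< m<n)))
                                         (increasing a' a (trans a≡1+m (cong suc (sym (FP.toℕ-fromℕ< m<n)))))
    where
    m<n : m ℕ.< n
    m<n = NP.<-trans (NP.n<1+n m) (subst (ℕ._< n) a≡1+m (FP.toℕ<n a))
    a' : Fin n
    a' = fromℕ< m<n

  at-most : ∀ m (a : Fin n) → suc (toℕ a + m) ≡ n → toℕ (g a) ℕ.≤ toℕ a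
  at-most zero a a-last = NP.≤-pred (subst (toℕ (g a) ℕ.<_) (trans (sym a-last) (cong suc (NP.+-identityʳ _))) (FP.toℕ<n (g a)))
  at-most (suc m) a a+1+m-last = NP.≤-pred (NP.<-≤-trans (increasing a b b-adj) (subst (toℕ (g b) ℕ.≤_) b-adj (at-most m b b+m-last)))
    where
    1+a<n : suc (toℕ a) ℕ.< n
    1+a<n = subst (suc (suc (toℕ a)) ℕ.≤_) a+1+m-last (s≤s (subst (suc (toℕ a) ℕ.≤_) (sym (NP.+-suc (toℕ a) m)) (NP.m≤m+n (suc (toℕ a)) m)))
    b : Fin n
    b = fromℕ< 1+a<n
    b-adj : Adjacent a b
    b-adj = FP.toℕ-fromℕ< 1+a<n
    b+m-last : suc (toℕ b + m) ≡ n
    b+m-last = trans (cong (λ t → suc (t + m)) b-adj) (trans (cong suc (sym (NP.+-suc (toℕ a) m))) a+1+m-last)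

  identity : ∀ a → toℕ (g a) ≡ toℕ a
  identity a = NP.≤-antisym (at-most (n ∸ suc (toℕ a)) a (NP.m+[n∸m]≡n (FP.toℕ<n a))) (at-least (toℕ a) a refl)

-- Inversion containment: every inversion of u is one of w, stated as
-- "pairs of positions increasing in w are increasing in u".
InvSubset : ∀ {n} → Word n → Word n → Set
InvSubset u w = ∀ x y → x F.< y → lookup w x F.< lookup w y → lookup u x F.< lookup u y

-- Inversion numbers are bounded (by n², crudely written as a double sum).
maxInv : ℕ → ℕ
maxInv n = ∑ {n} λ _ → ∑ {n} λ _ → 1

inv-bounded : ∀ {n} (u : Word n) → inv u ℕ.≤ maxInv n
inv-bounded u = subst (ℕ._≤ _) (sym (inv≡∑ u))
  (∑-mono λ x → ∑-mono λ y → NP.≤-trans (when-≤ (x <? y) _) (when-≤ (lookup u y <? lookup u x) 1))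

-- Inversion containment implies left weak order: while u ≠ w there are
-- adjacent values a, a + 1 in increasing order in u whose positions are an
-- inversion of w; swapping them is a weak step that keeps containment.
module ClimbTo {n} (w : Word n) (pw : IsPerm w) where

  Ascent : (u : Word n) → IsPerm u → Set
  Ascent u pu = ∃ λ a → ∃ λ b → Adjacent a b × position u pu a F.< position u pu b ×
                lookup w (position u pu b) F.< lookup w (position u pu a)

  ascent? : ∀ u pu → Dec (Ascent u pu)
  ascent? u pu = FP.any? λ a → FP.any? λ b → (toℕ b NP.≟ suc (toℕ a)) ×-dec
    ((position u pu a <? position u pu b) ×-dec (lookup w (position u pu b) <? lookup w (position u pu a)))

  -- Without an ascent, w ∘ u⁻¹ increases along adjacent values, hence u = w.
  no-ascent⇒equal : ∀ u pu → InvSubset u w → ¬ Ascent u pu → u ≡ w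
  no-ascent⇒equal u pu u⊑w none = word-ext λ x → toℕ-injective (begin
    toℕ (lookup u x)                         ≡⟨ AdjacentIncreasing.identity g increasing (lookup u x) ⟨
    toℕ (g (lookup u x))                     ≡⟨ cong (λ t → toℕ (lookup w t)) (pu _ _ (lookup-position u pu (lookup u x))) ⟩
    toℕ (lookup w x)                         ∎)
    where
    open ≡-Reasoning
    pos : Fin n → Fin n
    pos = position u pu
    g : Fin n → Fin n
    g a = lookup w (pos a)
    distinct : ∀ {a b} → Adjacent a b → pos a ≢ pos b
    distinct {a} {b} adj pa≡pb = <⇒≢ (adjacent⇒< {a = a} {b} adj)
      (trans (sym (lookup-position u pu a)) (trans (cong (lookup u) pa≡pb) (lookup-position u pu b)))
    increasing : ∀ a b → Adjacent a b → g a F.< g b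
    increasing a b adj with <-cmp (pos a) (pos b) | <-cmp (g a) (g b)
    ... | _ | tri< ga<gb _ _ = ga<gb
    ... | _ | tri≈ _ ga≡gb _ = ⊥-elim (distinct adj (pw _ _ ga≡gb))
    ... | tri< pa<pb _ _ | tri> _ _ gb<ga = ⊥-elim (none (a , b , adj , pa<pb , gb<ga))
    ... | tri≈ _ pa≡pb _ | tri> _ _ _ = ⊥-elim (distinct adj pa≡pb)
    ... | tri> _ _ pb<pa | tri> _ _ gb<ga = ⊥-elim (<-asym (adjacent⇒< {a = a} {b} adj)
            (subst₂ F._<_ (lookup-position u pu b) (lookup-position u pu a) (u⊑w _ _ pb<pa gb<ga)))

  ascent-step : ∀ u pu → ((a , b , _) : Ascent u pu) → inv (lmulT a b u) ≡ suc (inv u)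
  ascent-step u pu (a , b , adj , pa<pb , _) = trans (cong inv (lmulT≡rmulT u pu a b))
    (Exchange.exchange-covers u (pos a) (pos b) pa<pb ua<ub nothing-between)
    where
    pos : Fin n → Fin n
    pos = position u pu
    ua<ub : lookup u (pos a) F.< lookup u (pos b)
    ua<ub = subst₂ F._<_ (sym (lookup-position u pu a)) (sym (lookup-position u pu b)) (adjacent⇒< {a = a} {b} adj)
    nothing-between : Exchange.NoValueBetween u (pos a) (pos b) pa<pb ua<ub
    nothing-between k pa<k k<pb with adjacent-gap {t = lookup u k} adj
           (λ uk≡a → <⇒≢ pa<k (sym (pu k (pos a) (trans uk≡a (sym (lookup-position u pu a))))))
           (λ uk≡b → <⇒≢ k<pb (pu k (pos b) (trans uk≡b (sym (lookup-position u pu b)))))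
    ... | inj₁ uk<a = inj₁ (subst (lookup u k F.<_) (sym (lookup-position u pu a)) uk<a)
    ... | inj₂ b<uk = inj₂ (subst (F._< lookup u k) (sym (lookup-position u pu b)) b<uk)

  ascent-subset : ∀ u pu → InvSubset u w → ((a , b , _) : Ascent u pu) → InvSubset (lmulT a b u) w
  ascent-subset u pu u⊑w (a , b , adj , _ , wb<wa) x y x<y wx<wy =
    subst₂ F._<_ (sym (lookup-lmulT a b u x)) (sym (lookup-lmulT a b u y))
      (adjacent-transpose-monotone a b adj (lookup u x) (lookup u y) (u⊑w x y x<y wx<wy) not-ab)
    where
    not-ab : ¬ (lookup u x ≡ a × lookup u y ≡ b)
    not-ab (ux≡a , uy≡b) with pu x (position u pu a) (trans ux≡a (sym (lookup-position u pu a)))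
                            | pu y (position u pu b) (trans uy≡b (sym (lookup-position u pu b)))
    ... | refl | refl = <-asym wx<wy wb<wa

  -- Climbing terminates since inversion numbers are bounded.
  climb : ∀ fuel u pu → InvSubset u w → maxInv n ℕ.< inv u + fuel → WeakLe u w
  climb fuel u pu u⊑w room with ascent? u pu
  ... | no none = subst (WeakLe u) (no-ascent⇒equal u pu u⊑w none) weak-refl
  ... | yes (a , b , asc) with fuel
  ...   | zero = ⊥-elim (NP.<⇒≱ room (subst (ℕ._≤ maxInv n) (sym (NP.+-identityʳ _)) (inv-bounded u)))
  ...   | suc fuel' = weak-step a b (proj₁ asc) step
          (climb fuel' (lmulT a b u) (lmulT-perm a b u pu) (ascent-subset u pu u⊑w (a , b , asc))
                 (subst (maxInv n ℕ.<_) (trans (NP.+-suc (inv u) fuel') (cong (_+ fuel') (sym step))) room))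
    where
    step : inv (lmulT a b u) ≡ suc (inv u)
    step = ascent-step u pu (a , b , asc)

inversions-within⇒weak : ∀ {n} (w : Word n) → IsPerm w → (u : Word n) → IsPerm u → InvSubset u w → WeakLe u w
inversions-within⇒weak {n} w pw u pu u⊑w =
  ClimbTo.climb w pw (suc (maxInv n)) u pu u⊑w (NP.m≤n+m (suc (maxInv n)) (inv u))

Pat231 : ∀ {n} → Word n → Fin n → Fin n → Fin n → Set
Pat231 w x y z = lookup w z F.< lookup w x × lookup w x F.< lookup w y

Pat312 : ∀ {n} → Word n → Fin n → Fin n → Fin n → Set
Pat312 w x y z = lookup w y F.< lookup w z × lookup w z F.< lookup w x

record Occurrence {n} (P : Fin n → Fin n → Fin n → Set) : Set where
  constructor occurrence
  field
    {x y z} : Fin n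
    x<y : x F.< y
    y<z : y F.< z
    matches : P x y z

occurrence231 : ∀ {n} (w : Word n) → Contains w p231 → Occurrence (Pat231 w)
occurrence231 w (f , increasing , order) =
  occurrence (increasing zero (suc zero) (s≤s z≤n)) (increasing (suc zero) (suc (suc zero)) (s≤s (s≤s z≤n)))
    (Equivalence.to (order (suc (suc zero)) zero) (s≤s z≤n) , Equivalence.to (order zero (suc zero)) (s≤s (s≤s z≤n)))

occurrence312 : ∀ {n} (w : Word n) → Contains w p312 → Occurrence (Pat312 w)
occurrence312 w (f , increasing , order) =
  occurrence (increasing zero (suc zero) (s≤s z≤n)) (increasing (suc zero) (suc (suc zero)) (s≤s (s≤s z≤n)))
    (Equivalence.to (order (suc zero) (suc (suc zero))) (s≤s z≤n) , Equivalence.to (order (suc (suc zero)) zero) (s≤s (s≤s z≤n)))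

-- Conversely, an explicit occurrence gives containment.  The comparisons
-- that are false for the pattern are discharged by deciding them.

not-< : ∀ {n} (a b : Fin n) → {False (a <? b)} → ¬ (a F.< b)
not-< a b {a≮b} = toWitnessFalse a≮b

triple : ∀ {n} → Fin n → Fin n → Fin n → Fin 3 → Fin n
triple x y z zero = x
triple x y z (suc zero) = y
triple x y z (suc (suc zero)) = z

triple-increasing : ∀ {n} {x y z : Fin n} → x F.< y → y F.< z → ∀ a b → a F.< b → triple x y z a F.< triple x y z b
triple-increasing x<y y<z zero (suc zero) _ = x<y
triple-increasing x<y y<z zero (suc (suc zero)) _ = <-trans x<y y<z
triple-increasing x<y y<z (suc zero) (suc (suc zero)) _ = y<z
triple-increasing x<y y<z zero zero a<b = ⊥-elim (not-< {3} zero zero a<b)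
triple-increasing x<y y<z (suc zero) zero a<b = ⊥-elim (not-< {3} (suc zero) zero a<b)
triple-increasing x<y y<z (suc zero) (suc zero) a<b = ⊥-elim (not-< {3} (suc zero) (suc zero) a<b)
triple-increasing x<y y<z (suc (suc zero)) zero a<b = ⊥-elim (not-< {3} (suc (suc zero)) zero a<b)
triple-increasing x<y y<z (suc (suc zero)) (suc zero) a<b = ⊥-elim (not-< {3} (suc (suc zero)) (suc zero) a<b)
triple-increasing x<y y<z (suc (suc zero)) (suc (suc zero)) a<b = ⊥-elim (not-< {3} (suc (suc zero)) (suc (suc zero)) a<b)

-- Containment of π from an increasing f along which w respects the order of
-- π; the converse comparisons follow since π and w ∘ f are injective.
contains : ∀ {n} (w : Word n) (π : Vec (Fin 3) 3) (f : Fin 3 → Fin n) →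
  (∀ a b → a F.< b → f a F.< f b) → (∀ a b → lookup π a ≡ lookup π b → a ≡ b) →
  (∀ a b → lookup π a F.< lookup π b → lookup w (f a) F.< lookup w (f b)) → Contains w π
contains w π f increasing π-injective respects = f , increasing , λ a b → mk⇔ (respects a b) (reflects a b)
  where
  reflects : ∀ a b → lookup w (f a) F.< lookup w (f b) → lookup π a F.< lookup π b
  reflects a b wfa<wfb with <-cmp (lookup π a) (lookup π b)
  ... | tri< πa<πb _ _ = πa<πb
  ... | tri≈ _ πa≡πb _ = ⊥-elim (<⇒≢ wfa<wfb (cong (λ t → lookup w (f t)) (π-injective a b πa≡πb)))
  ... | tri> _ _ πb<πa = ⊥-elim (<-asym wfa<wfb (respects b a πb<πa))

injective? : (π : Vec (Fin 3) 3) → Dec (∀ a b → lookup π a ≡ lookup π b → a ≡ b)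
injective? π = FP.all? λ a → FP.all? λ b → (lookup π a ≟ lookup π b) →-dec (a ≟ b)

contains231 : ∀ {n} (w : Word n) {x y z : Fin n} → x F.< y → y F.< z → Pat231 w x y z → Contains w p231
contains231 w {x} {y} {z} x<y y<z (wz<wx , wx<wy) =
  contains w p231 (triple x y z) (triple-increasing x<y y<z) (toWitness {a? = injective? p231} tt) respects
  where
  π : Fin 3 → Fin 3
  π = lookup p231
  respects : ∀ a b → π a F.< π b → lookup w (triple x y z a) F.< lookup w (triple x y z b)
  respects zero (suc zero) _ = wx<wy
  respects (suc (suc zero)) zero _ = wz<wx
  respects (suc (suc zero)) (suc zero) _ = <-trans wz<wx wx<wy
  respects zero zero πa<πb = ⊥-elim (not-< (π zero) (π zero) πa<πb)
  respects zero (suc (suc zero)) πa<πb = ⊥-elim (not-< (π zero) (π (suc (suc zero))) πa<πb)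
  respects (suc zero) zero πa<πb = ⊥-elim (not-< (π (suc zero)) (π zero) πa<πb)
  respects (suc zero) (suc zero) πa<πb = ⊥-elim (not-< (π (suc zero)) (π (suc zero)) πa<πb)
  respects (suc zero) (suc (suc zero)) πa<πb = ⊥-elim (not-< (π (suc zero)) (π (suc (suc zero))) πa<πb)
  respects (suc (suc zero)) (suc (suc zero)) πa<πb = ⊥-elim (not-< (π (suc (suc zero))) (π (suc (suc zero))) πa<πb)

contains312 : ∀ {n} (w : Word n) {x y z : Fin n} → x F.< y → y F.< z → Pat312 w x y z → Contains w p312
contains312 w {x} {y} {z} x<y y<z (wy<wz , wz<wx) =
  contains w p312 (triple x y z) (triple-increasing x<y y<z) (toWitness {a? = injective? p312} tt) respects
  where
  π : Fin 3 → Fin 3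
  π = lookup p312
  respects : ∀ a b → π a F.< π b → lookup w (triple x y z a) F.< lookup w (triple x y z b)
  respects (suc zero) zero _ = <-trans wy<wz wz<wx
  respects (suc zero) (suc (suc zero)) _ = wy<wz
  respects (suc (suc zero)) zero _ = wz<wx
  respects zero zero πa<πb = ⊥-elim (not-< (π zero) (π zero) πa<πb)
  respects zero (suc zero) πa<πb = ⊥-elim (not-< (π zero) (π (suc zero)) πa<πb)
  respects zero (suc (suc zero)) πa<πb = ⊥-elim (not-< (π zero) (π (suc (suc zero))) πa<πb)
  respects (suc zero) (suc zero) πa<πb = ⊥-elim (not-< (π (suc zero)) (π (suc zero)) πa<πb)
  respects (suc (suc zero)) (suc zero) πa<πb = ⊥-elim (not-< (π (suc (suc zero))) (π (suc zero)) πa<πb)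
  respects (suc (suc zero)) (suc (suc zero)) πa<πb = ⊥-elim (not-< (π (suc (suc zero))) (π (suc (suc zero))) πa<πb)

-- The only pairs (x, y)
-- needing an argument are those involving i or j; for (j, y) with y > j and
-- (x, i) with x < i a failure would exhibit a 312 resp. 231 in w.
containment-descends : ∀ {n} (w : Word n) → IsPerm w → Avoids w p231 → Avoids w p312 →
  (u : Word n) (i j : Fin n) (i<j : i F.< j) → lookup u i F.< lookup u j →
  InvSubset (rmulT i j u) w → InvSubset u w
containment-descends {n} w pw avoid231 avoid312 u i j i<j ui<uj u'⊑w x y x<y wx<wy = byRegion (region x) (region y)
  where
  open Exchange u i j i<j ui<uj using (σ; Region; region; at-i; at-j; below; inner; above; σ-i; σ-j; σ-below; σ-inner; σ-above)
  swapped : ∀ {x y a b} → x F.< y → lookup w x F.< lookup w y → σ x ≡ a → σ y ≡ b → lookup u a F.< lookup u b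
  swapped {x} {y} x<y wx<wy refl refl = subst₂ F._<_ (lookup-rmulT i j u x) (lookup-rmulT i j u y) (u'⊑w x y x<y wx<wy)
  byRegion : Region x → Region y → lookup u x F.< lookup u y
  byRegion (at-i refl) (at-j refl) = ui<uj
  byRegion (at-i refl) (inner i<y y<j) = <-trans ui<uj (swapped x<y wx<wy σ-i (σ-inner i<y y<j))
  byRegion (at-i refl) (above j<y) = <-trans ui<uj (swapped x<y wx<wy σ-i (σ-above j<y))
  byRegion (at-j refl) (above j<y) with <-cmp (lookup w i) (lookup w y)
  ... | tri< wi<wy _ _ = swapped (<-trans i<j j<y) wi<wy σ-i (σ-above j<y)
  ... | tri≈ _ wi≡wy _ = ⊥-elim (<⇒≢ (<-trans i<j j<y) (pw i y wi≡wy))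
  ... | tri> _ _ wy<wi = ⊥-elim (avoid312 (contains312 w i<j j<y (wx<wy , wy<wi)))
  byRegion (below x<i) (at-i refl) with <-cmp (lookup w x) (lookup w j)
  ... | tri< wx<wj _ _ = swapped (<-trans x<i i<j) wx<wj (σ-below x<i) σ-j
  ... | tri≈ _ wx≡wj _ = ⊥-elim (<⇒≢ (<-trans x<i i<j) (pw x j wx≡wj))
  ... | tri> _ _ wj<wx = ⊥-elim (avoid231 (contains231 w x<i i<j (wj<wx , wx<wy)))
  byRegion (below x<i) (at-j refl) = <-trans (swapped x<y wx<wy (σ-below x<i) σ-j) ui<uj
  byRegion (inner i<x x<j) (at-j refl) = <-trans (swapped x<y wx<wy (σ-inner i<x x<j) σ-j) ui<uj
  byRegion (at-i refl) (at-i refl) = ⊥-elim (<-irrefl refl x<y)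
  byRegion (at-i refl) (below y<i) = ⊥-elim (<-asym x<y y<i)
  byRegion (at-j refl) (at-i refl) = ⊥-elim (<-asym x<y i<j)
  byRegion (at-j refl) (at-j refl) = ⊥-elim (<-irrefl refl x<y)
  byRegion (at-j refl) (below y<i) = ⊥-elim (<-asym x<y (<-trans y<i i<j))
  byRegion (at-j refl) (inner _ y<j) = ⊥-elim (<-asym x<y y<j)
  byRegion (inner i<x _) (at-i refl) = ⊥-elim (<-asym x<y i<x)
  byRegion (above j<x) (at-i refl) = ⊥-elim (<-asym x<y (<-trans i<j j<x))
  byRegion (above j<x) (at-j refl) = ⊥-elim (<-asym x<y j<x)
  byRegion (below x<i) (below y<i) = swapped x<y wx<wy (σ-below x<i) (σ-below y<i)
  byRegion (below x<i) (inner i<y y<j) = swapped x<y wx<wy (σ-below x<i) (σ-inner i<y y<j)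
  byRegion (below x<i) (above j<y) = swapped x<y wx<wy (σ-below x<i) (σ-above j<y)
  byRegion (inner i<x x<j) (below y<i) = swapped x<y wx<wy (σ-inner i<x x<j) (σ-below y<i)
  byRegion (inner i<x x<j) (inner i<y y<j) = swapped x<y wx<wy (σ-inner i<x x<j) (σ-inner i<y y<j)
  byRegion (inner i<x x<j) (above j<y) = swapped x<y wx<wy (σ-inner i<x x<j) (σ-above j<y)
  byRegion (above j<x) (below y<i) = swapped x<y wx<wy (σ-above j<x) (σ-below y<i)
  byRegion (above j<x) (inner i<y y<j) = swapped x<y wx<wy (σ-above j<x) (σ-inner i<y y<j)
  byRegion (above j<x) (above j<y) = swapped x<y wx<wy (σ-above j<x) (σ-above j<y)

bruhat⇒containment : ∀ {n} (w : Word n) → IsPerm w → Avoids w p231 → Avoids w p312 →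
  (u : Word n) → IsPerm u → BruhatLe u w → InvSubset u w
bruhat⇒containment w pw avoid231 avoid312 u pu bruhat-refl = λ _ _ _ wx<wy → wx<wy
bruhat⇒containment w pw avoid231 avoid312 u pu (bruhat-step i j step rest) =
  descend (bruhat-step-ascent u pu i j step) (bruhat⇒containment w pw avoid231 avoid312 (rmulT i j u) (rmulT-perm i j u pu) rest)
  where
  descend : (i F.< j × lookup u i F.< lookup u j) ⊎ (j F.< i × lookup u j F.< lookup u i) →
            InvSubset (rmulT i j u) w → InvSubset u w
  descend (inj₁ (i<j , ui<uj)) u'⊑w = containment-descends w pw avoid231 avoid312 u i j i<j ui<uj u'⊑w
  descend (inj₂ (j<i , uj<ui)) u'⊑w =
    containment-descends w pw avoid231 avoid312 u j i j<i uj<ui (subst (λ t → InvSubset t w) (rmulT-sym i j u) u'⊑w)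

Gap : ∀ {n} → Word n → Fin n → Fin n → Set
Gap w a b = ∀ k → a F.< k → k F.< b → lookup w k F.< lookup w b ⊎ lookup w a F.< lookup w k

descent-cover : ∀ {n} (w : Word n) {a b : Fin n} (a<b : a F.< b) → lookup w b F.< lookup w a → Gap w a b →
                BruhatLe (rmulT a b w) w
descent-cover {n} w {a} {b} a<b wb<wa gap =
  bruhat-step a b (Exchange.exchange-covers u a b a<b ua<ub no-value-between)
    (subst (λ t → BruhatLe t w) (sym (rmulT-involutive a b w)) bruhat-refl)
  where
  u : Word n
  u = rmulT a b w
  ua<ub : lookup u a F.< lookup u b
  ua<ub = subst₂ F._<_ (sym (rmulT-at-i w a b)) (sym (rmulT-at-j w a b)) wb<wa
  no-value-between : Exchange.NoValueBetween u a b a<b ua<ub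
  no-value-between k a<k k<b = fromGap (gap k a<k k<b)
    where
    uk≡wk : lookup u k ≡ lookup w k
    uk≡wk = rmulT-other w a b k (≢-sym (<⇒≢ a<k)) (<⇒≢ k<b)
    fromGap : lookup w k F.< lookup w b ⊎ lookup w a F.< lookup w k → lookup u k F.< lookup u a ⊎ lookup u b F.< lookup u k
    fromGap (inj₁ wk<wb) = inj₁ (subst₂ F._<_ (sym uk≡wk) (sym (rmulT-at-i w a b)) wk<wb)
    fromGap (inj₂ wa<wk) = inj₂ (subst₂ F._<_ (sym (rmulT-at-j w a b)) (sym uk≡wk) wa<wk)

-- Any occurrence of 231 can be tightened so that its last two entries
-- satisfy the gap condition: an intermediate value would give an
-- occurrence with z - y smaller.
tighten231 : ∀ {n} (w : Word n) → IsPerm w → ∀ bound (o : Occurrence (Pat231 w)) →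
             toℕ (Occurrence.z o) ∸ toℕ (Occurrence.y o) ℕ.≤ bound →
             Σ (Occurrence (Pat231 w)) λ o → Gap w (Occurrence.y o) (Occurrence.z o)
tighten231 w pw bound o@(occurrence {x} {y} {z} x<y y<z (wz<wx , wx<wy)) small
  with FP.any? (λ k → (y <? k) ×-dec ((k <? z) ×-dec ((lookup w z <? lookup w k) ×-dec (lookup w k <? lookup w y))))
... | no none = o , gap
  where
  gap : Gap w y z
  gap k y<k k<z with <-cmp (lookup w k) (lookup w z) | <-cmp (lookup w k) (lookup w y)
  ... | tri< wk<wz _ _ | _ = inj₁ wk<wz
  ... | tri≈ _ wk≡wz _ | _ = ⊥-elim (<⇒≢ k<z (pw k z wk≡wz))
  ... | tri> _ _ wz<wk | tri< wk<wy _ _ = ⊥-elim (none (k , y<k , k<z , wz<wk , wk<wy))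
  ... | tri> _ _ _ | tri≈ _ wk≡wy _ = ⊥-elim (<⇒≢ y<k (sym (pw k y wk≡wy)))
  ... | tri> _ _ _ | tri> _ _ wy<wk = inj₂ wy<wk
... | yes (k , y<k , k<z , _ , wk<wy) with bound | <-cmp (lookup w k) (lookup w x)
...   | zero | _ = ⊥-elim (NP.<⇒≱ (NP.m<n⇒0<n∸m y<z) small)
...   | suc bound' | tri< wk<wx _ _ = tighten231 w pw bound' (occurrence x<y y<k (wk<wx , wx<wy))
          (NP.≤-pred (NP.<-≤-trans (NP.∸-monoˡ-< k<z (NP.<⇒≤ y<k)) small))
...   | suc bound' | tri≈ _ wk≡wx _ = ⊥-elim (<⇒≢ (<-trans x<y y<k) (sym (pw k x wk≡wx)))
...   | suc bound' | tri> _ _ wx<wk = tighten231 w pw bound' (occurrence (<-trans x<y y<k) k<z (wz<wx , wx<wk))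
          (NP.≤-pred (NP.<-≤-trans (NP.∸-monoʳ-< y<k (NP.<⇒≤ k<z)) small))

-- Likewise for 312, tightening its first two entries (shrinking y - x).
tighten312 : ∀ {n} (w : Word n) → IsPerm w → ∀ bound (o : Occurrence (Pat312 w)) →
             toℕ (Occurrence.y o) ∸ toℕ (Occurrence.x o) ℕ.≤ bound →
             Σ (Occurrence (Pat312 w)) λ o → Gap w (Occurrence.x o) (Occurrence.y o)
tighten312 w pw bound o@(occurrence {x} {y} {z} x<y y<z (wy<wz , wz<wx)) small
  with FP.any? (λ k → (x <? k) ×-dec ((k <? y) ×-dec ((lookup w y <? lookup w k) ×-dec (lookup w k <? lookup w x))))
... | no none = o , gap
  where
  gap : Gap w x y
  gap k x<k k<y with <-cmp (lookup w k) (lookup w y) | <-cmp (lookup w k) (lookup w x)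
  ... | tri< wk<wy _ _ | _ = inj₁ wk<wy
  ... | tri≈ _ wk≡wy _ | _ = ⊥-elim (<⇒≢ k<y (pw k y wk≡wy))
  ... | tri> _ _ wy<wk | tri< wk<wx _ _ = ⊥-elim (none (k , x<k , k<y , wy<wk , wk<wx))
  ... | tri> _ _ _ | tri≈ _ wk≡wx _ = ⊥-elim (<⇒≢ x<k (sym (pw k x wk≡wx)))
  ... | tri> _ _ _ | tri> _ _ wx<wk = inj₂ wx<wk
... | yes (k , x<k , k<y , wy<wk , _) with bound | <-cmp (lookup w k) (lookup w z)
...   | zero | _ = ⊥-elim (NP.<⇒≱ (NP.m<n⇒0<n∸m x<y) small)
...   | suc bound' | tri> _ _ wz<wk = tighten312 w pw bound' (occurrence k<y y<z (wy<wz , wz<wk))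
          (NP.≤-pred (NP.<-≤-trans (NP.∸-monoʳ-< x<k (NP.<⇒≤ k<y)) small))
...   | suc bound' | tri≈ _ wk≡wz _ = ⊥-elim (<⇒≢ (<-trans k<y y<z) (pw k z wk≡wz))
...   | suc bound' | tri< wk<wz _ _ = tighten312 w pw bound' (occurrence x<k (<-trans k<y y<z) (wk<wz , wz<wx))
          (NP.≤-pred (NP.<-≤-trans (NP.∸-monoˡ-< k<y (NP.<⇒≤ x<k)) small))

record BruhatNotWeak {n} (w : Word n) : Set where
  constructor witness
  field
    u : Word n
    u-perm : IsPerm u
    bruhat : BruhatLe u w
    not-weak : ¬ WeakLe u w

-- For a tight 231 at x < y < z, w (y,z) is a Bruhat cover below w, but
-- (x, y) is an inversion of w (y,z) and not of w.
witness231 : ∀ {n} (w : Word n) → IsPerm w → Contains w p231 → BruhatNotWeak w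
witness231 {n} w pw c with tighten231 w pw _ (occurrence231 w c) NP.≤-refl
... | occurrence {x} {y} {z} x<y y<z (wz<wx , wx<wy) , gap =
  witness u (rmulT-perm y z w pw) (descent-cover w y<z (<-trans wz<wx wx<wy) gap) not-weak
  where
  u : Word n
  u = rmulT y z w
  not-weak : ¬ WeakLe u w
  not-weak u≤w = <-asym wx<wy (weak-keeps-inversions u (rmulT-perm y z w pw) u≤w x y x<y
    (subst₂ F._<_ (sym (rmulT-at-i w y z)) (sym (rmulT-other w y z x (<⇒≢ x<y) (<⇒≢ (<-trans x<y y<z)))) wz<wx))

-- For a tight 312 at x < y < z, w (x,y) is a Bruhat cover below w, but
-- (y, z) is an inversion of w (x,y) and not of w.
witness312 : ∀ {n} (w : Word n) → IsPerm w → Contains w p312 → BruhatNotWeak w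
witness312 {n} w pw c with tighten312 w pw _ (occurrence312 w c) NP.≤-refl
... | occurrence {x} {y} {z} x<y y<z (wy<wz , wz<wx) , gap =
  witness u (rmulT-perm x y w pw) (descent-cover w x<y (<-trans wy<wz wz<wx) gap) not-weak
  where
  u : Word n
  u = rmulT x y w
  not-weak : ¬ WeakLe u w
  not-weak u≤w = <-asym wy<wz (weak-keeps-inversions u (rmulT-perm x y w pw) u≤w y z y<z
    (subst₂ F._<_ (sym (rmulT-other w x y z (≢-sym (<⇒≢ (<-trans x<y y<z))) (≢-sym (<⇒≢ y<z)))) (sym (rmulT-at-j w x y)) wz<wx))

remove : ∀ {A : Set} {x : A} (ys : List A) → x ∈ ys → List A
remove (_ ∷ ys) (here _) = ys
remove (y ∷ ys) (there x∈ys) = y ∷ remove ys x∈ys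

length-remove : ∀ {A : Set} {x : A} (ys : List A) (x∈ys : x ∈ ys) → length ys ≡ suc (length (remove ys x∈ys))
length-remove (_ ∷ ys) (here _) = refl
length-remove (y ∷ ys) (there x∈ys) = cong suc (length-remove ys x∈ys)

∈-remove : ∀ {A : Set} {x z : A} (ys : List A) (x∈ys : x ∈ ys) → z ∈ ys → z ≢ x → z ∈ remove ys x∈ys
∈-remove (_ ∷ ys) (here refl) (here refl) z≢x = ⊥-elim (z≢x refl)
∈-remove (_ ∷ ys) (here refl) (there z∈ys) _ = z∈ys
∈-remove (y ∷ ys) (there x∈ys) (here z≡y) _ = here z≡y
∈-remove (y ∷ ys) (there x∈ys) (there z∈ys) z≢x = there (∈-remove ys x∈ys z∈ys z≢x)

unique-⊆⇒length-≤ : ∀ {A : Set} {xs ys : List A} → Unique xs → (∀ {z} → z ∈ xs → z ∈ ys) → length xs ℕ.≤ length ys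
unique-⊆⇒length-≤ {xs = []} [] _ = z≤n
unique-⊆⇒length-≤ {xs = x ∷ xs} {ys} (x∉xs ∷ unique) xs⊆ys =
  subst (suc (length xs) ℕ.≤_) (sym (length-remove ys x∈ys))
    (s≤s (unique-⊆⇒length-≤ unique λ z∈xs → ∈-remove ys x∈ys (xs⊆ys (there z∈xs)) (λ z≡x → All.lookup x∉xs z∈xs (sym z≡x))))
  where
  x∈ys : x ∈ ys
  x∈ys = xs⊆ys (here refl)

card-mono : ∀ {n} {P Q : Word n → Set} {k l} → HasCard P k → HasCard Q l → (∀ u → P u → Q u) → k ℕ.≤ l
card-mono (xs , refl , xs-unique , xs-spec) (ys , refl , _ , ys-spec) P⇒Q =
  unique-⊆⇒length-≤ xs-unique λ {u} u∈xs →
    Equivalence.to (ys-spec u) (P⇒Q u (Equivalence.from (xs-spec u) u∈xs))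

card-strict : ∀ {n} {P Q : Word n → Set} {k l} → HasCard P k → HasCard Q l → (∀ u → P u → Q u) →
              (∃ λ u → Q u × ¬ P u) → suc k ℕ.≤ l
card-strict {P = P} (xs , refl , xs-unique , xs-spec) (ys , refl , _ , ys-spec) P⇒Q (u , Qu , ¬Pu) =
  unique-⊆⇒length-≤ (All.tabulate u∉xs ∷ xs-unique) extended⊆ys
  where
  u∉xs : ∀ {z} → z ∈ xs → u ≢ z
  u∉xs z∈xs refl = ¬Pu (Equivalence.from (xs-spec u) z∈xs)
  extended⊆ys : ∀ {z} → z ∈ u ∷ xs → z ∈ ys
  extended⊆ys (here refl) = Equivalence.to (ys-spec u) Qu
  extended⊆ys (there z∈xs) = Equivalence.to (ys-spec _) (P⇒Q _ (Equivalence.from (xs-spec _) z∈xs))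

corollary1p2 : (n : ℕ) (w : Word n) → IsPerm w →
    (k l : ℕ) → wk≡ w k → br≡ w l →
    (k ≡ l) ⇔ (Avoids w p231 × Avoids w p312)
corollary1p2 n w pw k l wk br = mk⇔ equal⇒avoids avoids⇒equal
  where
  weak⊆bruhat : ∀ u → IsPerm u × WeakLe u w → IsPerm u × BruhatLe u w
  weak⊆bruhat u (pu , u≤w) = pu , weak⇒bruhat u pu u≤w

  strictly-more : BruhatNotWeak w → suc k ℕ.≤ l
  strictly-more (witness u pu u≤w u≰w) = card-strict wk br weak⊆bruhat (u , (pu , u≤w) , u≰w ∘ proj₂)

  equal⇒avoids : k ≡ l → Avoids w p231 × Avoids w p312
  equal⇒avoids refl = (λ c → NP.<-irrefl refl (strictly-more (witness231 w pw c)))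
                    , (λ c → NP.<-irrefl refl (strictly-more (witness312 w pw c)))

  avoids⇒equal : Avoids w p231 × Avoids w p312 → k ≡ l
  avoids⇒equal (avoid231 , avoid312) = NP.≤-antisym (card-mono wk br weak⊆bruhat) (card-mono br wk bruhat⊆weak)
    where
    bruhat⊆weak : ∀ u → IsPerm u × BruhatLe u w → IsPerm u × WeakLe u w
    bruhat⊆weak u (pu , u≤w) = pu , inversions-within⇒weak w pw u pu (bruhat⇒containment w pw avoid231 avoid312 u pu u≤w)
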